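{- Let $M_1=\langle Q_1,\Sigma,\delta_1,q_{0_1},F_1\rangle$ and $M_2=\langle Q_2,\Sigma,\delta_2,q_{0_2},F_2\rangle$ be finite automata recognizing languages $Init$ and $Bad$, let $\tau$ be a length-preserving finite transducer over $\Sigma$ with relation $r_\tau$, and let $\Phi$ be the first-order encoding described in the context. If $r_\tau^*(Init)\cap Bad\neq\emptyset$, then $\Phi\vdash\exists x\,(R(x)\wedge Bad(x))$.
   Context: A finite automaton $\langle Q,\Sigma,\delta,q_0,F\rangle$ has $\delta\subseteq Q\times\Sigma\times Q$ and accepts $w$ iff there is a run on $w$ from $q_0$ ending in $F$. A length-preserving finite transducer is $\tau=\langle Q,\Sigma,\delta,q_0,F\rangle$ with $\delta\subseteq Q\times\Sigma\times\Sigma\times Q$; $r_\tau=\{\langle w,u\rangle\mid q_0\to^{w,u}q'$ for some $q'\in F\}$, where $\to^{w,u}$ is the run relation; $r_\tau^*$ is its reflexive–transitive closure and $r_\tau^*(Init)$ the image of $Init$. The sets $Q_1,Q_2,Q,\Sigma$ are pairwise disjoint. Vocabulary: constants for all elements of $\Sigma\cup Q_1\cup Q_2\cup Q$ plus a distinct constant $e$; binary function $*$; unary $R$, $Init$, $Bad$; binary $Trans$; ternary $T^{(3)}$; 4-ary $T^{(4)}$. $\Phi$ is the set of universal closures of: (1) $(x*y)*z=x*(y*z)$; (2) $T^{(3)}(q,e,q)$ for all $q\in Q_1\cup Q_2$; (3) $T^{(3)}(q,a,q')$ for all $(q,a,q')\in\delta_1\cup\delta_2$; (4) $T^{(3)}(x,y,z)\wedge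 T^{(3)}(z,v,w)\to T^{(3)}(x,y*v,w)$; (5) $\bigvee_{q\in F_1}T^{(3)}(q_{0_1},x,q)\to Init(x)$; (6) $\bigvee_{q\in F_2}T^{(3)}(q_{0_2},x,q)\to Bad(x)$; (7) $T^{(4)}(x,e,e,x)$; (8) $T^{(4)}(q,a,b,q')$ for all $(q,a,b,q')\in\delta$; (9) $T^{(4)}(x,y,z,v)\wedge T^{(4)}(v,y',z',w)\to T^{(4)}(x,y*y',z*z',w)$; (10) $Trans(x,y)\leftrightarrow\bigvee_{q\in F}T^{(4)}(q_0,x,y,q)$; (11) $Init(x)\to R(x)$; (12) $R(x)\wedge Trans(x,y)\to R(y)$. $\vdash$ is first-order derivability with equality. -}

module Defs where

open import Data.Nat using (ℕ; zero; suc)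
open import Data.Fin using (Fin; zero; suc; #_)
open import Data.List using (List; []; _∷_; map; foldr)
open import Data.List.Membership.Propositional using (_∈_)
open import Data.Product using (_×_; _,_; Σ; ∃)
open import Relation.Binary.Construct.Closure.ReflexiveTransitive using (Star)

Word : ℕ → Set
Word nΣ = List (Fin nΣ)

record Automaton (nΣ : ℕ) : Set where
  field
    nQ : ℕ
    q₀ : Fin nQ
    F  : List (Fin nQ)
    δ  : List (Fin nQ × Fin nΣ × Fin nQ)

record Transducer (nΣ : ℕ) : Set where
  field
    nQ : ℕ
    q₀ : Fin nQ
    F  : List (Fin nQ)
    δ  : List (Fin nQ × Fin nΣ × Fin nΣ × Fin nQ)

module _ {nΣ : ℕ} (M : Automaton nΣ) where
  open Automaton M

  data Run : Fin nQ → Word nΣ → Fin nQ → Set where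
    done : ∀ {q} → Run q [] q
    step : ∀ {q a q' w q''} → (q , a , q') ∈ δ → Run q' w q'' → Run q (a ∷ w) q''

  Accepts : Word nΣ → Set
  Accepts w = Σ (Fin nQ) λ q → q ∈ F × Run q₀ w q

module _ {nΣ : ℕ} (τ : Transducer nΣ) where
  open Transducer τ

  -- q →^{w,u} q'  (length preserving: one input and one output letter per step)
  data TRun : Fin nQ → Word nΣ → Word nΣ → Fin nQ → Set where
    done : ∀ {q} → TRun q [] [] q
    step : ∀ {q a b q' w u q''} → (q , a , b , q') ∈ δ →
           TRun q' w u q'' → TRun q (a ∷ w) (b ∷ u) q''

  rel : Word nΣ → Word nΣ → Set
  rel w u = Σ (Fin nQ) λ q → q ∈ F × TRun q₀ w u q

  rel* : Word nΣ → Word nΣ → Set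
  rel* = Star rel

module Encoding {nΣ : ℕ} (M₁ M₂ : Automaton nΣ) (τ : Transducer nΣ) where
  private
    module M₁ = Automaton M₁
    module M₂ = Automaton M₂
    module T  = Transducer τ

  -- constants: Σ ∪ Q₁ ∪ Q₂ ∪ Q (disjoint by tagging) plus e
  data Const : Set where
    letter : Fin nΣ → Const
    st₁    : Fin M₁.nQ → Const
    st₂    : Fin M₂.nQ → Const
    st     : Fin T.nQ → Const
    e      : Const

  -- terms with n free (de Bruijn) variables
  data Term (n : ℕ) : Set where
    var : Fin n → Term n
    con : Const → Term n
    _⊛_ : Term n → Term n → Term n

  infixl 7 _⊛_
  infix  6 _≐_
  infixr 5 _∧_
  infixr 4 _∨_
  infixr 3 _⇒_

  data Form (n : ℕ) : Set where
    Rₚ Initₚ Badₚ : Term n → Form n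
    Transₚ : Term n → Term n → Form n
    T³ : Term n → Term n → Term n → Form n
    T⁴ : Term n → Term n → Term n → Term n → Form n
    _≐_ : Term n → Term n → Form n
    ⊥ₚ : Form n
    _⇒_ _∧_ _∨_ : Form n → Form n → Form n
    ∀ₚ ∃ₚ : Form (suc n) → Form n

  liftR : ∀ {n m} → (Fin n → Fin m) → Fin (suc n) → Fin (suc m)
  liftR ρ zero = zero
  liftR ρ (suc i) = suc (ρ i)

  renT : ∀ {n m} → (Fin n → Fin m) → Term n → Term m
  renT ρ (var i) = var (ρ i)
  renT ρ (con c) = con c
  renT ρ (t ⊛ s) = renT ρ t ⊛ renT ρ s

  ren : ∀ {n m} → (Fin n → Fin m) → Form n → Form m
  ren ρ (Rₚ t) = Rₚ (renT ρ t)
  ren ρ (Initₚ t) = Initₚ (renT ρ t)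
  ren ρ (Badₚ t) = Badₚ (renT ρ t)
  ren ρ (Transₚ t s) = Transₚ (renT ρ t) (renT ρ s)
  ren ρ (T³ t s r) = T³ (renT ρ t) (renT ρ s) (renT ρ r)
  ren ρ (T⁴ t s r p) = T⁴ (renT ρ t) (renT ρ s) (renT ρ r) (renT ρ p)
  ren ρ (t ≐ s) = renT ρ t ≐ renT ρ s
  ren ρ ⊥ₚ = ⊥ₚ
  ren ρ (φ ⇒ ψ) = ren ρ φ ⇒ ren ρ ψ
  ren ρ (φ ∧ ψ) = ren ρ φ ∧ ren ρ ψ
  ren ρ (φ ∨ ψ) = ren ρ φ ∨ ren ρ ψ
  ren ρ (∀ₚ φ) = ∀ₚ (ren (liftR ρ) φ)
  ren ρ (∃ₚ φ) = ∃ₚ (ren (liftR ρ) φ)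

  liftS : ∀ {n m} → (Fin n → Term m) → Fin (suc n) → Term (suc m)
  liftS σ zero = var zero
  liftS σ (suc i) = renT suc (σ i)

  subT : ∀ {n m} → (Fin n → Term m) → Term n → Term m
  subT σ (var i) = σ i
  subT σ (con c) = con c
  subT σ (t ⊛ s) = subT σ t ⊛ subT σ s

  sub : ∀ {n m} → (Fin n → Term m) → Form n → Form m
  sub σ (Rₚ t) = Rₚ (subT σ t)
  sub σ (Initₚ t) = Initₚ (subT σ t)
  sub σ (Badₚ t) = Badₚ (subT σ t)
  sub σ (Transₚ t s) = Transₚ (subT σ t) (subT σ s)
  sub σ (T³ t s r) = T³ (subT σ t) (subT σ s) (subT σ r)
  sub σ (T⁴ t s r p) = T⁴ (subT σ t) (subT σ s) (subT σ r) (subT σ p)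
  sub σ (t ≐ s) = subT σ t ≐ subT σ s
  sub σ ⊥ₚ = ⊥ₚ
  sub σ (φ ⇒ ψ) = sub σ φ ⇒ sub σ ψ
  sub σ (φ ∧ ψ) = sub σ φ ∧ sub σ ψ
  sub σ (φ ∨ ψ) = sub σ φ ∨ sub σ ψ
  sub σ (∀ₚ φ) = ∀ₚ (sub (liftS σ) φ)
  sub σ (∃ₚ φ) = ∃ₚ (sub (liftS σ) φ)

  _[_] : ∀ {n} → Form (suc n) → Term n → Form n
  φ [ t ] = sub σ φ
    where
      σ : Fin (suc _) → Term _
      σ zero = t
      σ (suc i) = var i

  shift : ∀ {n} → Form n → Form (suc n)
  shift = ren suc

  closed : ∀ {n} → Form 0 → Form n
  closed = ren (λ ())

  -- finite disjunction (empty disjunction = ⊥)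
  ⋁ : ∀ {n} → List (Form n) → Form n
  ⋁ = foldr _∨_ ⊥ₚ

  c : ∀ {n} → Const → Term n
  c = con

  data Φ : Form 0 → Set where
    ax1  : Φ (∀ₚ (∀ₚ (∀ₚ ((var (# 2) ⊛ var (# 1)) ⊛ var (# 0) ≐ var (# 2) ⊛ (var (# 1) ⊛ var (# 0))))))
    ax2₁ : (q : Fin M₁.nQ) → Φ (T³ (c (st₁ q)) (c e) (c (st₁ q)))
    ax2₂ : (q : Fin M₂.nQ) → Φ (T³ (c (st₂ q)) (c e) (c (st₂ q)))
    ax3₁ : ∀ {q a q'} → (q , a , q') ∈ M₁.δ → Φ (T³ (c (st₁ q)) (c (letter a)) (c (st₁ q')))
    ax3₂ : ∀ {q a q'} → (q , a , q') ∈ M₂.δ → Φ (T³ (c (st₂ q)) (c (letter a)) (c (st₂ q')))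
    -- x = #4, y = #3, z = #2, v = #1, w = #0
    ax4  : Φ (∀ₚ (∀ₚ (∀ₚ (∀ₚ (∀ₚ
             (T³ (var (# 4)) (var (# 3)) (var (# 2)) ∧ T³ (var (# 2)) (var (# 1)) (var (# 0))
               ⇒ T³ (var (# 4)) (var (# 3) ⊛ var (# 1)) (var (# 0))))))))
    ax5  : Φ (∀ₚ (⋁ (map (λ q → T³ (c (st₁ M₁.q₀)) (var (# 0)) (c (st₁ q))) M₁.F) ⇒ Initₚ (var (# 0))))
    ax6  : Φ (∀ₚ (⋁ (map (λ q → T³ (c (st₂ M₂.q₀)) (var (# 0)) (c (st₂ q))) M₂.F) ⇒ Badₚ (var (# 0))))
    ax7  : Φ (∀ₚ (T⁴ (var (# 0)) (c e) (c e) (var (# 0))))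
    ax8  : ∀ {q a b q'} → (q , a , b , q') ∈ T.δ →
           Φ (T⁴ (c (st q)) (c (letter a)) (c (letter b)) (c (st q')))
    -- x = #6, y = #5, z = #4, v = #3, y' = #2, z' = #1, w = #0
    ax9  : Φ (∀ₚ (∀ₚ (∀ₚ (∀ₚ (∀ₚ (∀ₚ (∀ₚ
             (T⁴ (var (# 6)) (var (# 5)) (var (# 4)) (var (# 3))
                ∧ T⁴ (var (# 3)) (var (# 2)) (var (# 1)) (var (# 0))
               ⇒ T⁴ (var (# 6)) (var (# 5) ⊛ var (# 2)) (var (# 4) ⊛ var (# 1)) (var (# 0))))))))))
    -- biconditional written as a conjunction of two implications; x = #1, y = #0
    ax10 : Φ (∀ₚ (∀ₚ
             ((Transₚ (var (# 1)) (var (# 0))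
                 ⇒ ⋁ (map (λ q → T⁴ (c (st T.q₀)) (var (# 1)) (var (# 0)) (c (st q))) T.F))
              ∧ (⋁ (map (λ q → T⁴ (c (st T.q₀)) (var (# 1)) (var (# 0)) (c (st q))) T.F)
                 ⇒ Transₚ (var (# 1)) (var (# 0))))))
    ax11 : Φ (∀ₚ (Initₚ (var (# 0)) ⇒ Rₚ (var (# 0))))
    -- x = #1, y = #0
    ax12 : Φ (∀ₚ (∀ₚ (Rₚ (var (# 1)) ∧ Transₚ (var (# 1)) (var (# 0)) ⇒ Rₚ (var (# 0)))))

  infix 2 _⊢_
  data _⊢_ : ∀ {n} → List (Form n) → Form n → Set where
    hyp  : ∀ {n} {Γ : List (Form n)} {φ} → φ ∈ Γ → Γ ⊢ φ
    ax   : ∀ {n} {Γ : List (Form n)} {φ} → Φ φ → Γ ⊢ closed φ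
    ⇒I   : ∀ {n} {Γ : List (Form n)} {φ ψ} → φ ∷ Γ ⊢ ψ → Γ ⊢ φ ⇒ ψ
    ⇒E   : ∀ {n} {Γ : List (Form n)} {φ ψ} → Γ ⊢ φ ⇒ ψ → Γ ⊢ φ → Γ ⊢ ψ
    ∧I   : ∀ {n} {Γ : List (Form n)} {φ ψ} → Γ ⊢ φ → Γ ⊢ ψ → Γ ⊢ φ ∧ ψ
    ∧E₁  : ∀ {n} {Γ : List (Form n)} {φ ψ} → Γ ⊢ φ ∧ ψ → Γ ⊢ φ
    ∧E₂  : ∀ {n} {Γ : List (Form n)} {φ ψ} → Γ ⊢ φ ∧ ψ → Γ ⊢ ψ
    ∨I₁  : ∀ {n} {Γ : List (Form n)} {φ ψ} → Γ ⊢ φ → Γ ⊢ φ ∨ ψ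
    ∨I₂  : ∀ {n} {Γ : List (Form n)} {φ ψ} → Γ ⊢ ψ → Γ ⊢ φ ∨ ψ
    ∨E   : ∀ {n} {Γ : List (Form n)} {φ ψ χ} →
           Γ ⊢ φ ∨ ψ → φ ∷ Γ ⊢ χ → ψ ∷ Γ ⊢ χ → Γ ⊢ χ
    ⊥E   : ∀ {n} {Γ : List (Form n)} {φ} → Γ ⊢ ⊥ₚ → Γ ⊢ φ
    raa  : ∀ {n} {Γ : List (Form n)} {φ} → (φ ⇒ ⊥ₚ) ∷ Γ ⊢ ⊥ₚ → Γ ⊢ φ
    ∀I   : ∀ {n} {Γ : List (Form n)} {φ} → map shift Γ ⊢ φ → Γ ⊢ ∀ₚ φ
    ∀E   : ∀ {n} {Γ : List (Form n)} {φ} → Γ ⊢ ∀ₚ φ → (t : Term n) → Γ ⊢ φ [ t ]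
    ∃I   : ∀ {n} {Γ : List (Form n)} {φ} → (t : Term n) → Γ ⊢ φ [ t ] → Γ ⊢ ∃ₚ φ
    ∃E   : ∀ {n} {Γ : List (Form n)} {φ ψ} →
           Γ ⊢ ∃ₚ φ → φ ∷ map shift Γ ⊢ shift ψ → Γ ⊢ ψ
    ≐refl : ∀ {n} {Γ : List (Form n)} (t : Term n) → Γ ⊢ t ≐ t
    ≐subst : ∀ {n} {Γ : List (Form n)} (φ : Form (suc n)) {s t : Term n} →
           Γ ⊢ s ≐ t → Γ ⊢ φ [ s ] → Γ ⊢ φ [ t ]

  Derivable : Form 0 → Set
  Derivable ψ = [] ⊢ ψ

  goal : Form 0
  goal = ∃ₚ (Rₚ (var (# 0)) ∧ Badₚ (var (# 0)))

module Submission where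

-- A run of an automaton (or transducer) on a word is replayed
-- inside the theory Φ: the word w = a₁⋯aₙ is represented by the closed term
-- ⟦ w ⟧ = a₁ * (⋯ * (aₙ * e)), and every transition step is an axiom (3)/(8)
-- glued to the rest of the run by the composition axioms (4)/(9).  Hence an
-- accepting run of M₁ on w derives Init(⟦ w ⟧) and then R(⟦ w ⟧) by (11), an
-- accepting run of τ derives Trans, so (12) propagates R along r_τ^*, and an
-- accepting run of M₂ on u derives Bad(⟦ u ⟧); the witness ⟦ u ⟧ proves the goal.

open import Defs
open import Data.Nat using (ℕ; zero; suc)
open import Data.Fin using (Fin; zero; suc)
open import Data.List using (List; []; _∷_; map)
open import Data.List.Membership.Propositional using (_∈_)
open import Data.List.Relation.Unary.Any using (here; there)
open import Data.Product using (_×_; Σ; _,_)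
open import Data.Vec.Functional using (Vector) renaming ([] to ∅; _∷_ to _▸_)
open import Relation.Binary.PropositionalEquality
  using (_≡_; refl; sym; cong; cong₂; subst; module ≡-Reasoning)
open import Relation.Binary.Construct.Closure.ReflexiveTransitive using (ε; _◅_)

module Development {nΣ : ℕ} (M₁ M₂ : Automaton nΣ) (τ : Transducer nΣ) where
  open Encoding M₁ M₂ τ
  open ≡-Reasoning

  Subst : ℕ → ℕ → Set
  Subst n m = Fin n → Term m

  T³-cong : ∀ {n} {t t′ s s′ r r′ : Term n} →
            t ≡ t′ → s ≡ s′ → r ≡ r′ → T³ t s r ≡ T³ t′ s′ r′
  T³-cong refl refl refl = refl

  T⁴-cong : ∀ {n} {t t′ s s′ r r′ p p′ : Term n} →
            t ≡ t′ → s ≡ s′ → r ≡ r′ → p ≡ p′ → T⁴ t s r p ≡ T⁴ t′ s′ r′ p′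
  T⁴-cong refl refl refl refl = refl

  subT-renT : ∀ {n m k} (σ : Subst m k) (ρ : Fin n → Fin m) (t : Term n) →
              subT σ (renT ρ t) ≡ subT (λ i → σ (ρ i)) t
  subT-renT σ ρ (var i) = refl
  subT-renT σ ρ (con a) = refl
  subT-renT σ ρ (t ⊛ s) = cong₂ _⊛_ (subT-renT σ ρ t) (subT-renT σ ρ s)

  renT-subT : ∀ {n m k} (ρ : Fin m → Fin k) (σ : Subst n m) (t : Term n) →
              renT ρ (subT σ t) ≡ subT (λ i → renT ρ (σ i)) t
  renT-subT ρ σ (var i) = refl
  renT-subT ρ σ (con a) = refl
  renT-subT ρ σ (t ⊛ s) = cong₂ _⊛_ (renT-subT ρ σ t) (renT-subT ρ σ s)

  subT-var : ∀ {n} (t : Term n) → subT var t ≡ t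
  subT-var (var i) = refl
  subT-var (con a) = refl
  subT-var (t ⊛ s) = cong₂ _⊛_ (subT-var t) (subT-var s)

  renT-as-subT : ∀ {n m} {ρ : Fin n → Fin m} {σ : Subst n m} →
                 (∀ i → var (ρ i) ≡ σ i) → ∀ t → renT ρ t ≡ subT σ t
  renT-as-subT h (var i) = h i
  renT-as-subT h (con a) = refl
  renT-as-subT h (t ⊛ s) = cong₂ _⊛_ (renT-as-subT h t) (renT-as-subT h s)

  liftR-as-liftS : ∀ {n m} {ρ : Fin n → Fin m} {σ : Subst n m} →
                   (∀ i → var (ρ i) ≡ σ i) → ∀ i → var (liftR ρ i) ≡ liftS σ i
  liftR-as-liftS h zero = refl
  liftR-as-liftS h (suc i) = cong (renT suc) (h i)

  ren-as-sub : ∀ {n m} {ρ : Fin n → Fin m} {σ : Subst n m} →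
               (∀ i → var (ρ i) ≡ σ i) → ∀ φ → ren ρ φ ≡ sub σ φ
  ren-as-sub h (Rₚ t) = cong Rₚ (renT-as-subT h t)
  ren-as-sub h (Initₚ t) = cong Initₚ (renT-as-subT h t)
  ren-as-sub h (Badₚ t) = cong Badₚ (renT-as-subT h t)
  ren-as-sub h (Transₚ t s) = cong₂ Transₚ (renT-as-subT h t) (renT-as-subT h s)
  ren-as-sub h (T³ t s r) = T³-cong (renT-as-subT h t) (renT-as-subT h s) (renT-as-subT h r)
  ren-as-sub h (T⁴ t s r p) =
    T⁴-cong (renT-as-subT h t) (renT-as-subT h s) (renT-as-subT h r) (renT-as-subT h p)
  ren-as-sub h (t ≐ s) = cong₂ _≐_ (renT-as-subT h t) (renT-as-subT h s)
  ren-as-sub h ⊥ₚ = refl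
  ren-as-sub h (φ ⇒ ψ) = cong₂ _⇒_ (ren-as-sub h φ) (ren-as-sub h ψ)
  ren-as-sub h (φ ∧ ψ) = cong₂ _∧_ (ren-as-sub h φ) (ren-as-sub h ψ)
  ren-as-sub h (φ ∨ ψ) = cong₂ _∨_ (ren-as-sub h φ) (ren-as-sub h ψ)
  ren-as-sub h (∀ₚ φ) = cong ∀ₚ (ren-as-sub (liftR-as-liftS h) φ)
  ren-as-sub h (∃ₚ φ) = cong ∃ₚ (ren-as-sub (liftR-as-liftS h) φ)

  subT-fusion : ∀ {n m k} {τ′ : Subst m k} {σ : Subst n m} {υ : Subst n k} →
                (∀ i → subT τ′ (σ i) ≡ υ i) → ∀ t → subT τ′ (subT σ t) ≡ subT υ t
  subT-fusion h (var i) = h i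
  subT-fusion h (con a) = refl
  subT-fusion h (t ⊛ s) = cong₂ _⊛_ (subT-fusion h t) (subT-fusion h s)

  liftS-fusion : ∀ {n m k} {τ′ : Subst m k} {σ : Subst n m} {υ : Subst n k} →
                 (∀ i → subT τ′ (σ i) ≡ υ i) → ∀ i → subT (liftS τ′) (liftS σ i) ≡ liftS υ i
  liftS-fusion h zero = refl
  liftS-fusion {τ′ = τ′} {σ} {υ} h (suc i) = begin
    subT (liftS τ′) (renT suc (σ i))      ≡⟨ subT-renT (liftS τ′) suc (σ i) ⟩
    subT (λ j → renT suc (τ′ j)) (σ i)    ≡⟨ sym (renT-subT suc τ′ (σ i)) ⟩
    renT suc (subT τ′ (σ i))              ≡⟨ cong (renT suc) (h i) ⟩
    renT suc (υ i)                        ∎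

  sub-fusion : ∀ {n m k} {τ′ : Subst m k} {σ : Subst n m} {υ : Subst n k} →
               (∀ i → subT τ′ (σ i) ≡ υ i) → ∀ φ → sub τ′ (sub σ φ) ≡ sub υ φ
  sub-fusion h (Rₚ t) = cong Rₚ (subT-fusion h t)
  sub-fusion h (Initₚ t) = cong Initₚ (subT-fusion h t)
  sub-fusion h (Badₚ t) = cong Badₚ (subT-fusion h t)
  sub-fusion h (Transₚ t s) = cong₂ Transₚ (subT-fusion h t) (subT-fusion h s)
  sub-fusion h (T³ t s r) = T³-cong (subT-fusion h t) (subT-fusion h s) (subT-fusion h r)
  sub-fusion h (T⁴ t s r p) =
    T⁴-cong (subT-fusion h t) (subT-fusion h s) (subT-fusion h r) (subT-fusion h p)
  sub-fusion h (t ≐ s) = cong₂ _≐_ (subT-fusion h t) (subT-fusion h s)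
  sub-fusion h ⊥ₚ = refl
  sub-fusion h (φ ⇒ ψ) = cong₂ _⇒_ (sub-fusion h φ) (sub-fusion h ψ)
  sub-fusion h (φ ∧ ψ) = cong₂ _∧_ (sub-fusion h φ) (sub-fusion h ψ)
  sub-fusion h (φ ∨ ψ) = cong₂ _∨_ (sub-fusion h φ) (sub-fusion h ψ)
  sub-fusion h (∀ₚ φ) = cong ∀ₚ (sub-fusion (liftS-fusion h) φ)
  sub-fusion h (∃ₚ φ) = cong ∃ₚ (sub-fusion (liftS-fusion h) φ)

  -- Substituting σ ∘ suc under a binder and then instantiating the bound
  -- variable with σ zero is substituting σ: this is how ∀E consumes one entry
  -- of a substitution.  (The substitution of φ [ t ] is local to Defs, hence _.)
  instantiate-outermost : ∀ {n m} (σ : Subst (suc n) m) (φ : Form (suc n)) →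
                          sub (liftS (λ i → σ (suc i))) φ [ σ zero ] ≡ sub σ φ
  instantiate-outermost σ φ = sub-fusion pointwise φ
    where
      pointwise : ∀ i → subT _ (liftS (λ j → σ (suc j)) i) ≡ σ i
      pointwise zero = refl
      pointwise (suc i) = begin
        subT _ (renT suc (σ (suc i)))  ≡⟨ subT-renT _ suc (σ (suc i)) ⟩
        subT var (σ (suc i))           ≡⟨ subT-var (σ (suc i)) ⟩
        σ (suc i)                      ∎

  -- The universal closure ∀x₁⋯∀xₖ φ; the bound variable xₖ is var zero in φ.
  ∀̄ : (k : ℕ) → Form k → Form 0
  ∀̄ zero φ = φ
  ∀̄ (suc k) φ = ∀̄ k (∀ₚ φ)

  -- A derivable universal closure may be instantiated with any closed
  -- substitution σ, where σ zero instantiates the innermost variable.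
  instantiate-⊢ : ∀ {Γ : List (Form 0)} k {φ : Form k} →
                  Γ ⊢ closed (∀̄ k φ) → (σ : Subst k 0) → Γ ⊢ sub σ φ
  instantiate-⊢ zero {φ} d σ = subst (_ ⊢_) (ren-as-sub (λ ()) φ) d
  instantiate-⊢ (suc k) {φ} d σ =
    subst (_ ⊢_) (instantiate-outermost σ φ)
      (∀E (instantiate-⊢ k d (λ i → σ (suc i))) (σ zero))

  instantiate : ∀ {Γ : List (Form 0)} {k} {φ : Form k} →
                (σ : Vector (Term 0) k) → Φ (∀̄ k φ) → Γ ⊢ sub σ φ
  instantiate {k = k} σ a = instantiate-⊢ k (ax a) σ

  sub-⋁ : ∀ {n m} {A : Set} (σ : Subst n m) (g : A → Form n) (L : List A) →
          sub σ (⋁ (map g L)) ≡ ⋁ (map (λ x → sub σ (g x)) L)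
  sub-⋁ σ g [] = refl
  sub-⋁ σ g (x ∷ L) = cong (sub σ (g x) ∨_) (sub-⋁ σ g L)

  ⋁-intro : ∀ {n} {Γ : List (Form n)} {A : Set} (f : A → Form n) {x : A} {L : List A} →
            x ∈ L → Γ ⊢ f x → Γ ⊢ ⋁ (map f L)
  ⋁-intro f (here refl) d = ∨I₁ d
  ⋁-intro f (there x∈L) d = ∨I₂ (⋁-intro f x∈L d)

  ⋁-intro-sub : ∀ {n m} {Γ : List (Form m)} {A : Set} (σ : Subst n m) (g : A → Form n)
                {x : A} {L : List A} → x ∈ L → Γ ⊢ sub σ (g x) → Γ ⊢ sub σ (⋁ (map g L))
  ⋁-intro-sub σ g {L = L} x∈L d =
    subst (_ ⊢_) (sym (sub-⋁ σ g L)) (⋁-intro (λ x → sub σ (g x)) x∈L d)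

  ⟦_⟧ : Word nΣ → Term 0
  ⟦ [] ⟧ = con e
  ⟦ a ∷ w ⟧ = con (letter a) ⊛ ⟦ w ⟧

  module _ {Γ : List (Form 0)} where

    T³-compose : ∀ {x y z v w : Term 0} →
                 Γ ⊢ T³ x y z → Γ ⊢ T³ z v w → Γ ⊢ T³ x (y ⊛ v) w
    T³-compose {x} {y} {z} {v} {w} d₁ d₂ =
      ⇒E (instantiate (w ▸ v ▸ z ▸ y ▸ x ▸ ∅) ax4) (∧I d₁ d₂)

    T⁴-compose : ∀ {x y z v y′ z′ w : Term 0} →
                 Γ ⊢ T⁴ x y z v → Γ ⊢ T⁴ v y′ z′ w → Γ ⊢ T⁴ x (y ⊛ y′) (z ⊛ z′) w
    T⁴-compose {x} {y} {z} {v} {y′} {z′} {w} d₁ d₂ =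
      ⇒E (instantiate (w ▸ z′ ▸ y′ ▸ v ▸ z ▸ y ▸ x ▸ ∅) ax9) (∧I d₁ d₂)

    module Simulation (M : Automaton nΣ) (ι : Fin (Automaton.nQ M) → Const)
        (loop : ∀ q → Γ ⊢ T³ (con (ι q)) (con e) (con (ι q)))
        (edge : ∀ {q a q′} → (q , a , q′) ∈ Automaton.δ M →
                Γ ⊢ T³ (con (ι q)) (con (letter a)) (con (ι q′))) where

      run-T³ : ∀ {q w q′} → Run M q w q′ → Γ ⊢ T³ (con (ι q)) ⟦ w ⟧ (con (ι q′))
      run-T³ {q} done = loop q
      run-T³ (step t r) = T³-compose (edge t) (run-T³ r)

    trun-T⁴ : ∀ {q w u q′} → TRun τ q w u q′ → Γ ⊢ T⁴ (con (st q)) ⟦ w ⟧ ⟦ u ⟧ (con (st q′))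
    trun-T⁴ {q} done = instantiate (con (st q) ▸ ∅) ax7
    trun-T⁴ (step t r) = T⁴-compose (ax (ax8 t)) (trun-T⁴ r)

    module Run₁ = Simulation M₁ st₁ (λ q → ax (ax2₁ q)) (λ t → ax (ax3₁ t))
    module Run₂ = Simulation M₂ st₂ (λ q → ax (ax2₂ q)) (λ t → ax (ax3₂ t))

    initial-R : ∀ {w} → Accepts M₁ w → Γ ⊢ Rₚ ⟦ w ⟧
    initial-R {w} (q , q∈F , r) =
      ⇒E (instantiate (⟦ w ⟧ ▸ ∅) ax11)
         (⇒E (instantiate (⟦ w ⟧ ▸ ∅) ax5) (⋁-intro-sub _ _ q∈F (Run₁.run-T³ r)))

    bad : ∀ {u} → Accepts M₂ u → Γ ⊢ Badₚ ⟦ u ⟧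
    bad {u} (q , q∈F , r) =
      ⇒E (instantiate (⟦ u ⟧ ▸ ∅) ax6) (⋁-intro-sub _ _ q∈F (Run₂.run-T³ r))

    transition : ∀ {w u} → rel τ w u → Γ ⊢ Transₚ ⟦ w ⟧ ⟦ u ⟧
    transition {w} {u} (q , q∈F , r) =
      ⇒E (∧E₂ (instantiate (⟦ u ⟧ ▸ ⟦ w ⟧ ▸ ∅) ax10)) (⋁-intro-sub _ _ q∈F (trun-T⁴ r))

    reachable-R : ∀ {w u} → Γ ⊢ Rₚ ⟦ w ⟧ → rel* τ w u → Γ ⊢ Rₚ ⟦ u ⟧
    reachable-R d ε = d
    reachable-R {w} d (_◅_ {j = v} r rs) =
      reachable-R (⇒E (instantiate (⟦ v ⟧ ▸ ⟦ w ⟧ ▸ ∅) ax12) (∧I d (transition r))) rs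

corollary2 : {nΣ : ℕ} (M₁ M₂ : Automaton nΣ) (τ : Transducer nΣ) →
    Σ (Word nΣ) (λ u → Σ (Word nΣ) (λ w → Accepts M₁ w × rel* τ w u) × Accepts M₂ u) →
    Encoding.Derivable M₁ M₂ τ (Encoding.goal M₁ M₂ τ)
corollary2 M₁ M₂ τ (u , (w , w∈Init , w→*u) , u∈Bad) =
  ∃I ⟦ u ⟧ (∧I (reachable-R (initial-R w∈Init) w→*u) (bad u∈Bad))
  where
    open Encoding M₁ M₂ τ
    open Development M₁ M₂ τ
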